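{- Let $n\geq 2$ and $k\geq 1$ be integers. Let $HM_{n,k}$ (resp. $PM_{n,k}$) be the total number of humps (resp. peaks) of height $k$ in all Motzkin paths of order $n$, i.e. the number of pairs $(M,P)$ where $M$ is a Motzkin path of order $n$ and $P$ is a hump (resp. peak) of $M$ of height $k$. Then \begin{align*} HM_{n,k}&=\sum_{j=0}^{n-2k}\chi(j\equiv n \pmod 2)\,\frac{4k}{n-j+2k}\binom{n}{j}\binom{n-j-1}{(n-j)/2+k-1},\\ PM_{n,k}&=\sum_{j=0}^{n-2k}\chi(j\equiv n \pmod 2)\,\frac{4k}{n-j+2k}\binom{n-1}{j}\binom{n-j-1}{(n-j)/2+k-1}, \end{align*} where $\chi(\cdot)$ equals $1$ if the condition holds and $0$ otherwise. Moreover, the summation index $j$ counts the number of flat steps of the corresponding Motzkin paths (i.e. the $j$-th summand counts those pairs $(M,P)$ in which $M$ has exactly $j$ flat steps).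
   Context: A Motzkin path of order $n$ is a lattice path from $(0,0)$ to $(n,0)$ using up steps $U=(1,1)$, down steps $D=(1,-1)$ and flat steps $F=(1,0)$ that never goes below the $x$-axis. A hump in a Motzkin path is a consecutive sequence of steps consisting of an up step, followed by zero or more flat steps, followed by a down step; a peak is a hump with no flat steps. The height of a hump is the $y$-coordinate reached by the up step of the hump. -}

module Defs where

open import Data.Nat using (ℕ; zero; suc; _+_; _≡ᵇ_; pred)
open import Data.Integer using (+_)
open import Data.Bool using (Bool; true; false; _∧_; if_then_else_)
open import Data.List using (List; []; _∷_; map; concatMap; length; filter)
open import Data.Rational using (ℚ; _/_; 0ℚ; 1ℚ) renaming (_+_ to _+ℚ_)

-- Steps of a Motzkin path: U = (1,1), D = (1,-1), F = (1,0).
data Step : Set where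
  U D F : Step

allWords : ℕ → List (List Step)
allWords zero    = [] ∷ []
allWords (suc n) = concatMap (λ s → map (s ∷_) (allWords n)) (U ∷ D ∷ F ∷ [])

validFrom : ℕ → List Step → Bool
validFrom zero    []      = true
validFrom (suc _) []      = false
validFrom h       (U ∷ w) = validFrom (suc h) w
validFrom zero    (D ∷ w) = false
validFrom (suc h) (D ∷ w) = validFrom h w
validFrom h       (F ∷ w) = validFrom h w

isMotzkin : List Step → Bool
isMotzkin = validFrom 0

flats : List Step → ℕ
flats []      = 0
flats (F ∷ w) = suc (flats w)
flats (_ ∷ w) = flats w

-- The steps following an up step are F^m D (m ≥ 0): the up step starts a hump.
flatsThenD : List Step → Bool
flatsThenD (F ∷ w) = flatsThenD w
flatsThenD (D ∷ w) = true
flatsThenD _       = false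

-- The step following an up step is D: the up step starts a peak.
startsD : List Step → Bool
startsD (D ∷ _) = true
startsD _       = false

b2n : Bool → ℕ
b2n true  = 1
b2n false = 0

-- A hump/peak is identified with its
-- (unique) initial up step; its height is the height reached by that up step.
countFrom : (List Step → Bool) → ℕ → ℕ → List Step → ℕ
countFrom t k h []      = 0
countFrom t k h (U ∷ w) = b2n ((suc h ≡ᵇ k) ∧ t w) + countFrom t k (suc h) w
countFrom t k h (D ∷ w) = countFrom t k (pred h) w
countFrom t k h (F ∷ w) = countFrom t k h w

humpsOfHeight : ℕ → List Step → ℕ
humpsOfHeight k = countFrom flatsThenD k 0

peaksOfHeight : ℕ → List Step → ℕ
peaksOfHeight k = countFrom startsD k 0

sumℕ : List ℕ → ℕ
sumℕ []       = 0
sumℕ (x ∷ xs) = x + sumℕ xs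

HM : ℕ → ℕ → ℕ
HM n k = sumℕ (map (λ w → if isMotzkin w then humpsOfHeight k w else 0) (allWords n))

PM : ℕ → ℕ → ℕ
PM n k = sumℕ (map (λ w → if isMotzkin w then peaksOfHeight k w else 0) (allWords n))

HMflat : ℕ → ℕ → ℕ → ℕ
HMflat n k j = sumℕ (map (λ w → if isMotzkin w ∧ (flats w ≡ᵇ j) then humpsOfHeight k w else 0) (allWords n))

PMflat : ℕ → ℕ → ℕ → ℕ
PMflat n k j = sumℕ (map (λ w → if isMotzkin w ∧ (flats w ≡ᵇ j) then peaksOfHeight k w else 0) (allWords n))

ℕtoℚ : ℕ → ℚ
ℕtoℚ m = + m / 1

-- a / d as a rational; the value for d = 0 is an irrelevant convention
-- (never used: the theorem only divides by n - j + 2k ≥ 2k ≥ 2).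
frac : ℕ → ℕ → ℚ
frac a zero    = 0ℚ
frac a (suc d) = + a / suc d

χ : Bool → ℚ
χ true  = 1ℚ
χ false = 0ℚ

sumBelow : ℕ → (ℕ → ℚ) → ℚ
sumBelow zero    f = 0ℚ
sumBelow (suc m) f = sumBelow m f +ℚ f m

-- Deleting the flat steps of a Motzkin path with j flat steps leaves a walk of d = n − j steps ±1
-- that stays nonnegative, and turns a hump of height k into a peak of height k; conversely the
-- flats can be put back in C(n, j) ways, or in C(n − 1, j) ways when the gap inside a marked
-- peak must stay empty.  Peaks of height k in walks of length d from 0 to 0 correspond to walks
-- of length d − 1 from 0 to 2k − 1, and the reflection principle counts those as
-- C(d − 1, d/2 + k − 1) − C(d − 1, d/2 + k) = 4k/(d + 2k) · C(d − 1, d/2 + k − 1) for even d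
-- (and 0 for odd d).

module Submission where

open import Defs
open import Data.Nat using (ℕ; suc; _≤_; _∸_; _+_; _*_; _/_; _%_; _≡ᵇ_)
open import Data.Nat.Combinatorics using (_C_)
open import Data.Rational using (ℚ) renaming (_*_ to _*ℚ_)
open import Data.Product using (_×_)
open import Relation.Binary.PropositionalEquality using (_≡_)

open import Data.Bool using (Bool; true; false; _∧_; if_then_else_; T)
open import Data.Bool.Properties using (∧-zeroʳ)
import Data.Integer as ℤ
import Data.Integer.Properties as ℤ
open import Data.List using (List; []; _∷_; map; concatMap; length; _++_)
open import Data.List.Properties using (map-∘)
open import Data.Nat using (zero; pred; _<_; z≤n; s≤s; s≤s⁻¹)
open import Data.Nat.Combinatorics using (nCk+nC[k+1]≡[n+1]C[k+1]; k>n⇒nCk≡0; nCk≡nC[n∸k]; nC1≡n)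
open import Data.Nat.DivMod using ([m+kn]%n≡m%n; m*n/n≡m)
open import Data.Nat.Properties
open import Algebra.Properties.CommutativeSemigroup +-commutativeSemigroup using () renaming (interchange to +-interchange)
open import Data.Nat.Tactic.RingSolver using (solve-∀)
open import Data.Product using (_,_)
open import Data.Rational using (0ℚ; 1ℚ; toℚᵘ) renaming (_+_ to _+ℚ_)
open import Data.Rational.Properties using (toℚᵘ-injective; toℚᵘ-fromℚᵘ; toℚᵘ-homo-*; toℚᵘ-homo-+)
  renaming (*-zeroˡ to *ℚ-zeroˡ; *-identityˡ to *ℚ-identityˡ)
open import Data.Rational.Unnormalised as ℚᵘ using (mkℚᵘ; *≡*) renaming (_≃_ to _≃ᵘ_)
import Data.Rational.Unnormalised.Properties as ℚᵘ
open import Data.Unit using (tt)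
open import Relation.Binary.PropositionalEquality using (_≢_; refl; sym; trans; cong; cong₂; subst; module ≡-Reasoning)
open import Relation.Nullary using (yes; no; contradiction)

lower : ℕ → ℕ → (ℕ → ℕ) → ℕ
lower zero    h       f = f h
lower (suc m) zero    f = 0
lower (suc m) (suc h) f = lower m h f

lower-cong : ∀ m h {f g : ℕ → ℕ} → (∀ x → f x ≡ g x) → lower m h f ≡ lower m h g
lower-cong zero    h       f≗g = f≗g h
lower-cong (suc m) zero    f≗g = refl
lower-cong (suc m) (suc h) f≗g = lower-cong m h f≗g

lower-zero : ∀ m h → lower m h (λ _ → 0) ≡ 0
lower-zero zero    h       = refl
lower-zero (suc m) zero    = refl
lower-zero (suc m) (suc h) = lower-zero m h

*-distribˡ-lower : ∀ c m h (f : ℕ → ℕ) → c * lower m h f ≡ lower m h (λ x → c * f x)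
*-distribˡ-lower c zero    h       f = refl
*-distribˡ-lower c (suc m) zero    f = *-zeroʳ c
*-distribˡ-lower c (suc m) (suc h) f = *-distribˡ-lower c m h f

lower-+ : ∀ m h (f g : ℕ → ℕ) → lower m h (λ x → f x + g x) ≡ lower m h f + lower m h g
lower-+ zero    h       f g = refl
lower-+ (suc m) zero    f g = refl
lower-+ (suc m) (suc h) f g = lower-+ m h f g

lower-suc : ∀ m h (f : ℕ → ℕ) → lower (suc m) h f ≡ lower 1 h (λ h' → lower m h' f)
lower-suc m zero    f = refl
lower-suc m (suc h) f = refl

lower-comm : ∀ h t (g : ℕ → ℕ → ℕ) → lower 1 h (λ x → lower 1 t (g x)) ≡ lower 1 t (λ y → lower 1 h (λ x → g x y))
lower-comm zero    t       g = sym (lower-zero 1 t)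
lower-comm (suc h) zero    g = refl
lower-comm (suc h) (suc t) g = refl

*-if : ∀ c b x → c * (if b then x else 0) ≡ (if b then c * x else 0)
*-if c true  x = refl
*-if c false x = *-zeroʳ c

if-zero : ∀ b {x} → x ≡ 0 → (if b then x else 0) ≡ 0
if-zero true  x≡0 = x≡0
if-zero false x≡0 = refl

≡ᵇ-refl : ∀ n → (n ≡ᵇ n) ≡ true
≡ᵇ-refl zero    = refl
≡ᵇ-refl (suc n) = ≡ᵇ-refl n

≡ᵇ-true⇒≡ : ∀ x y → (x ≡ᵇ y) ≡ true → x ≡ y
≡ᵇ-true⇒≡ x y x≡ᵇy = ≡ᵇ⇒≡ x y (subst T (sym x≡ᵇy) tt)

≢⇒≡ᵇ-false : ∀ {x y} → x ≢ y → (x ≡ᵇ y) ≡ false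
≢⇒≡ᵇ-false {x} {y} x≢y with x ≡ᵇ y in x≡ᵇy
... | false = refl
... | true  = contradiction (≡ᵇ-true⇒≡ x y x≡ᵇy) x≢y

sumBelowℕ : ℕ → (ℕ → ℕ) → ℕ
sumBelowℕ zero    f = 0
sumBelowℕ (suc M) f = sumBelowℕ M f + f M

sumBelowℕ-zero : ∀ M → sumBelowℕ M (λ _ → 0) ≡ 0
sumBelowℕ-zero zero    = refl
sumBelowℕ-zero (suc M) = trans (+-identityʳ _) (sumBelowℕ-zero M)

sumBelowℕ-+ : ∀ M (f g : ℕ → ℕ) → sumBelowℕ M (λ j → f j + g j) ≡ sumBelowℕ M f + sumBelowℕ M g
sumBelowℕ-+ zero    f g = refl
sumBelowℕ-+ (suc M) f g = trans (cong (_+ (f M + g M)) (sumBelowℕ-+ M f g)) (+-interchange (sumBelowℕ M f) _ _ _)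

sumBelowℕ-indicator : ∀ x c M → x < M → sumBelowℕ M (λ j → if x ≡ᵇ j then c else 0) ≡ c
sumBelowℕ-indicator x c (suc M) x<1+M with x ≟ M
... | yes refl = cong₂ _+_ (below x ≤-refl) (cong (if_then c else 0) (≡ᵇ-refl x))
  where
  below : ∀ M → M ≤ x → sumBelowℕ M (λ j → if x ≡ᵇ j then c else 0) ≡ 0
  below zero    _   = refl
  below (suc M) M<x = cong₂ _+_ (below M (<⇒≤ M<x)) (cong (if_then c else 0) (≢⇒≡ᵇ-false (>⇒≢ M<x)))
... | no  x≢M  = trans (cong₂ _+_ (sumBelowℕ-indicator x c M (≤∧≢⇒< (s≤s⁻¹ x<1+M) x≢M))
                                  (cong (if_then c else 0) (≢⇒≡ᵇ-false x≢M)))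
                       (+-identityʳ c)

sumBelowℕ-truncate : ∀ M r (f : ℕ → ℕ) → (∀ j → M ≤ j → f j ≡ 0) → sumBelowℕ (M + r) f ≡ sumBelowℕ M f
sumBelowℕ-truncate M zero    f tail-zero = cong (λ N → sumBelowℕ N f) (+-identityʳ M)
sumBelowℕ-truncate M (suc r) f tail-zero rewrite +-suc M r =
  trans (cong₂ _+_ (sumBelowℕ-truncate M r f tail-zero) (tail-zero (M + r) (m≤m+n M r))) (+-identityʳ _)

module _ {A : Set} where

  sumℕ-map-++ : ∀ (f : A → ℕ) xs ys → sumℕ (map f (xs ++ ys)) ≡ sumℕ (map f xs) + sumℕ (map f ys)
  sumℕ-map-++ f []       ys = refl
  sumℕ-map-++ f (x ∷ xs) ys = trans (cong (f x +_) (sumℕ-map-++ f xs ys)) (sym (+-assoc (f x) _ _))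

  sumℕ-map-+ : ∀ (f g : A → ℕ) xs → sumℕ (map (λ x → f x + g x) xs) ≡ sumℕ (map f xs) + sumℕ (map g xs)
  sumℕ-map-+ f g []       = refl
  sumℕ-map-+ f g (x ∷ xs) = trans (cong (f x + g x +_) (sumℕ-map-+ f g xs)) (+-interchange (f x) (g x) _ _)

  sumℕ-map-concatMap : ∀ {B : Set} (f : A → ℕ) (g : B → List A) xs →
    sumℕ (map f (concatMap g xs)) ≡ sumℕ (map (λ x → sumℕ (map f (g x))) xs)
  sumℕ-map-concatMap f g []       = refl
  sumℕ-map-concatMap f g (x ∷ xs) =
    trans (sumℕ-map-++ f (g x) _) (cong (sumℕ (map f (g x)) +_) (sumℕ-map-concatMap f g xs))

  sumℕ-map-sumBelowℕ : ∀ M (g : ℕ → A → ℕ) xs →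
    sumℕ (map (λ x → sumBelowℕ M (λ j → g j x)) xs) ≡ sumBelowℕ M (λ j → sumℕ (map (g j) xs))
  sumℕ-map-sumBelowℕ M g []       = sym (sumBelowℕ-zero M)
  sumℕ-map-sumBelowℕ M g (x ∷ xs) =
    trans (cong (sumBelowℕ M (λ j → g j x) +_) (sumℕ-map-sumBelowℕ M g xs)) (sym (sumBelowℕ-+ M _ _))

sumBelow-cong : ∀ M {f g : ℕ → ℚ} → (∀ j → j < M → f j ≡ g j) → sumBelow M f ≡ sumBelow M g
sumBelow-cong zero    f≗g = refl
sumBelow-cong (suc M) f≗g = cong₂ _+ℚ_ (sumBelow-cong M (λ j j<M → f≗g j (m<n⇒m<1+n j<M))) (f≗g M ≤-refl)

Σwords : ℕ → (List Step → ℕ) → ℕ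
Σwords n f = sumℕ (map f (allWords n))

Σwords-suc : ∀ n f → Σwords (suc n) f ≡
  Σwords n (λ w → f (U ∷ w)) + Σwords n (λ w → f (D ∷ w)) + Σwords n (λ w → f (F ∷ w))
Σwords-suc n f = begin
  Σwords (suc n) f
    ≡⟨ sumℕ-map-concatMap f (λ s → map (s ∷_) (allWords n)) (U ∷ D ∷ F ∷ []) ⟩
  first U + (first D + (first F + 0))
    ≡⟨ cong₂ _+_ (Σwords-∷ U) (cong₂ _+_ (Σwords-∷ D) (trans (+-identityʳ _) (Σwords-∷ F))) ⟩
  Σwords n (λ w → f (U ∷ w)) + (Σwords n (λ w → f (D ∷ w)) + Σwords n (λ w → f (F ∷ w)))
    ≡⟨ sym (+-assoc (Σwords n (λ w → f (U ∷ w))) _ _) ⟩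
  Σwords n (λ w → f (U ∷ w)) + Σwords n (λ w → f (D ∷ w)) + Σwords n (λ w → f (F ∷ w)) ∎
  where
  open ≡-Reasoning
  first : Step → ℕ
  first s = sumℕ (map f (map (s ∷_) (allWords n)))
  Σwords-∷ : ∀ s → first s ≡ Σwords n (λ w → f (s ∷ w))
  Σwords-∷ s = cong sumℕ (sym (map-∘ (allWords n)))

Σwords-cong : ∀ n {f g : List Step → ℕ} → (∀ w → length w ≡ n → f w ≡ g w) → Σwords n f ≡ Σwords n g
Σwords-cong zero    f≗g = cong (_+ 0) (f≗g [] refl)
Σwords-cong (suc n) {f} {g} f≗g =
  trans (Σwords-suc n f) (trans (cong₂ _+_ (cong₂ _+_ (after U) (after D)) (after F)) (sym (Σwords-suc n g)))
  where
  after : ∀ s → Σwords n (λ w → f (s ∷ w)) ≡ Σwords n (λ w → g (s ∷ w))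
  after s = Σwords-cong n (λ w |w|≡n → f≗g (s ∷ w) (cong suc |w|≡n))

Σwords-+ : ∀ n (f g : List Step → ℕ) → Σwords n (λ w → f w + g w) ≡ Σwords n f + Σwords n g
Σwords-+ n f g = sumℕ-map-+ f g (allWords n)

Σwords-zero : ∀ n → Σwords n (λ _ → 0) ≡ 0
Σwords-zero zero    = refl
Σwords-zero (suc n) = trans (Σwords-suc n (λ _ → 0)) (cong (λ z → z + z + z) (Σwords-zero n))

Σwords-lower₁ : ∀ n m (g : ℕ → List Step → ℕ) → Σwords n (λ w → lower 1 m (λ x → g x w)) ≡ lower 1 m (λ x → Σwords n (g x))
Σwords-lower₁ n zero    g = Σwords-zero n
Σwords-lower₁ n (suc m) g = refl

flats≤length : ∀ w → flats w ≤ length w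
flats≤length []      = z≤n
flats≤length (U ∷ w) = m≤n⇒m≤1+n (flats≤length w)
flats≤length (D ∷ w) = m≤n⇒m≤1+n (flats≤length w)
flats≤length (F ∷ w) = s≤s (flats≤length w)

Σmotzkin-by-flats : ∀ n (g : List Step → ℕ) →
  Σwords n (λ w → if isMotzkin w then g w else 0) ≡
  sumBelowℕ (suc n) (λ j → Σwords n (λ w → if isMotzkin w ∧ (flats w ≡ᵇ j) then g w else 0))
Σmotzkin-by-flats n g =
  trans (Σwords-cong n (λ w |w|≡n → sym (one-flat-count (isMotzkin w) (s≤s (subst (flats w ≤_) |w|≡n (flats≤length w))))))
        (sumℕ-map-sumBelowℕ (suc n) _ (allWords n))
  where
  one-flat-count : ∀ {x c} b → x < suc n → sumBelowℕ (suc n) (λ j → if b ∧ (x ≡ᵇ j) then c else 0) ≡ (if b then c else 0)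
  one-flat-count {x} {c} true  x<1+n = sumBelowℕ-indicator x c (suc n) x<1+n
  one-flat-count         false _     = sumBelowℕ-zero (suc n)

Σpaths : ℕ → ℕ → ℕ → (List Step → ℕ) → ℕ
Σpaths n h j f = Σwords n (λ w → if validFrom h w ∧ (flats w ≡ᵇ j) then f w else 0)

validFrom-U : ∀ h w → validFrom h (U ∷ w) ≡ validFrom (suc h) w
validFrom-U zero    w = refl
validFrom-U (suc h) w = refl

validFrom-F : ∀ h w → validFrom h (F ∷ w) ≡ validFrom h w
validFrom-F zero    w = refl
validFrom-F (suc h) w = refl

guard-D : ∀ w h j x → (if validFrom h (D ∷ w) ∧ (flats w ≡ᵇ j) then x else 0) ≡
                      lower 1 h (λ h' → if validFrom h' w ∧ (flats w ≡ᵇ j) then x else 0)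
guard-D w zero    j x = refl
guard-D w (suc h) j x = refl

guard-F : ∀ w h j x → (if validFrom h (F ∷ w) ∧ (suc (flats w) ≡ᵇ j) then x else 0) ≡
                      lower 1 j (λ j' → if validFrom h w ∧ (flats w ≡ᵇ j') then x else 0)
guard-F w h zero    x rewrite validFrom-F h w | ∧-zeroʳ (validFrom h w) = refl
guard-F w h (suc j) x rewrite validFrom-F h w = refl

Σpaths-suc : ∀ n h j f → Σpaths (suc n) h j f ≡
  Σpaths n (suc h) j (λ w → f (U ∷ w)) + lower 1 h (λ h' → Σpaths n h' j (λ w → f (D ∷ w)))
    + lower 1 j (λ j' → Σpaths n h j' (λ w → f (F ∷ w)))
Σpaths-suc n h j f = trans (Σwords-suc n _) (cong₂ _+_ (cong₂ _+_ up down) flat)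
  where
  up : Σwords n (λ w → if validFrom h (U ∷ w) ∧ (flats w ≡ᵇ j) then f (U ∷ w) else 0) ≡
       Σpaths n (suc h) j (λ w → f (U ∷ w))
  up = Σwords-cong n (λ w _ → cong (λ b → if b ∧ (flats w ≡ᵇ j) then f (U ∷ w) else 0) (validFrom-U h w))
  down : Σwords n (λ w → if validFrom h (D ∷ w) ∧ (flats w ≡ᵇ j) then f (D ∷ w) else 0) ≡
         lower 1 h (λ h' → Σpaths n h' j (λ w → f (D ∷ w)))
  down = trans (Σwords-cong n (λ w _ → guard-D w h j (f (D ∷ w)))) (Σwords-lower₁ n h _)
  flat : Σwords n (λ w → if validFrom h (F ∷ w) ∧ (suc (flats w) ≡ᵇ j) then f (F ∷ w) else 0) ≡
         lower 1 j (λ j' → Σpaths n h j' (λ w → f (F ∷ w)))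
  flat = trans (Σwords-cong n (λ w _ → guard-F w h j (f (F ∷ w)))) (Σwords-lower₁ n j _)

Σpaths-cong : ∀ n h j {f g : List Step → ℕ} → (∀ w → length w ≡ n → f w ≡ g w) → Σpaths n h j f ≡ Σpaths n h j g
Σpaths-cong n h j f≗g = Σwords-cong n (λ w |w|≡n → cong (if validFrom h w ∧ (flats w ≡ᵇ j) then_else 0) (f≗g w |w|≡n))

Σpaths-+ : ∀ n h j (f g : List Step → ℕ) → Σpaths n h j (λ w → f w + g w) ≡ Σpaths n h j f + Σpaths n h j g
Σpaths-+ n h j f g = trans (Σwords-cong n (λ w _ → if-+ (validFrom h w ∧ (flats w ≡ᵇ j)))) (Σwords-+ n _ _)
  where
  if-+ : ∀ b {x y} → (if b then x + y else 0) ≡ (if b then x else 0) + (if b then y else 0)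
  if-+ true  = refl
  if-+ false = refl

Σpaths-zero : ∀ n h j → Σpaths n h j (λ _ → 0) ≡ 0
Σpaths-zero n h j = trans (Σwords-cong n (λ w _ → if-zero (validFrom h w ∧ (flats w ≡ᵇ j)) refl)) (Σwords-zero n)

Σpaths-nil : ∀ h j (f : List Step → ℕ) → f [] ≡ 0 → Σpaths 0 h j f ≡ 0
Σpaths-nil h j f f[]≡0 = cong (_+ 0) (if-zero (validFrom h [] ∧ (0 ≡ᵇ j)) f[]≡0)

paths : ℕ → ℕ → ℕ → ℕ
paths n h j = Σpaths n h j (λ _ → 1)

pathsWith : (List Step → Bool) → ℕ → ℕ → ℕ → ℕ
pathsWith t n h j = Σpaths n h j (λ w → b2n (t w))

marks : (List Step → Bool) → ℕ → ℕ → ℕ → ℕ → ℕ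
marks t k n h j = Σpaths n h j (countFrom t k h)

paths-suc : ∀ n h j → paths (suc n) h j ≡ paths n (suc h) j + lower 1 h (λ h' → paths n h' j) + lower 1 j (paths n h)
paths-suc n h j = Σpaths-suc n h j (λ _ → 1)

pathsWith-flatsThenD-suc : ∀ n h j →
  pathsWith flatsThenD (suc n) (suc h) j ≡ paths n h j + lower 1 j (pathsWith flatsThenD n (suc h))
pathsWith-flatsThenD-suc n h j =
  trans (Σpaths-suc n (suc h) j _) (cong (λ z → z + paths n h j + lower 1 j (pathsWith flatsThenD n (suc h))) (Σpaths-zero n (suc (suc h)) j))

pathsWith-startsD-suc : ∀ n h j → pathsWith startsD (suc n) (suc h) j ≡ paths n h j
pathsWith-startsD-suc n h j = begin
  pathsWith startsD (suc n) (suc h) j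
    ≡⟨ Σpaths-suc n (suc h) j _ ⟩
  Σpaths n (suc (suc h)) j (λ _ → 0) + paths n h j + lower 1 j (λ j' → Σpaths n (suc h) j' (λ _ → 0))
    ≡⟨ cong₂ (λ x y → x + paths n h j + y) (Σpaths-zero n (suc (suc h)) j)
             (trans (lower-cong 1 j (Σpaths-zero n (suc h))) (lower-zero 1 j)) ⟩
  paths n h j + 0
    ≡⟨ +-identityʳ _ ⟩
  paths n h j ∎
  where open ≡-Reasoning

marks-suc : ∀ t k n h j → marks t k (suc n) h j ≡
  (if suc h ≡ᵇ k then pathsWith t n (suc h) j else 0) + marks t k n (suc h) j
    + lower 1 h (λ h' → marks t k n h' j) + lower 1 j (marks t k n h)
marks-suc t k n h j = begin
  marks t k (suc n) h j
    ≡⟨ Σpaths-suc n h j (countFrom t k h) ⟩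
  Σpaths n (suc h) j (λ w → b2n ((suc h ≡ᵇ k) ∧ t w) + countFrom t k (suc h) w)
    + lower 1 h (λ h' → Σpaths n h' j (countFrom t k (pred h))) + lower 1 j (marks t k n h)
    ≡⟨ cong₂ (λ x y → x + y + lower 1 j (marks t k n h))
             (trans (Σpaths-+ n (suc h) j _ _) (cong (_+ marks t k n (suc h) j) (marked-here (suc h ≡ᵇ k))))
             (descend h) ⟩
  (if suc h ≡ᵇ k then pathsWith t n (suc h) j else 0) + marks t k n (suc h) j
    + lower 1 h (λ h' → marks t k n h' j) + lower 1 j (marks t k n h) ∎
  where
  open ≡-Reasoning
  marked-here : ∀ b → Σpaths n (suc h) j (λ w → b2n (b ∧ t w)) ≡ (if b then pathsWith t n (suc h) j else 0)
  marked-here true  = refl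
  marked-here false = Σpaths-zero n (suc h) j
  descend : ∀ h → lower 1 h (λ h' → Σpaths n h' j (countFrom t k (pred h))) ≡ lower 1 h (λ h' → marks t k n h' j)
  descend zero    = refl
  descend (suc h) = refl

-- Deleting the flat steps

-- walks L h t counts the walks of L steps ±1 from height h to height t that never go below 0.
walks : ℕ → ℕ → ℕ → ℕ
walks zero    h t = b2n (h ≡ᵇ t)
walks (suc L) h t = walks L (suc h) t + lower 1 h (λ h' → walks L h' t)

-- The walks of length L from h + 1 to 0 whose first step is down.
downWalks : ℕ → ℕ → ℕ
downWalks L h = lower 1 L (λ L' → walks L' h 0)

-- peaks k L h counts the pairs of a walk of length L from h to 0 and a peak of it whose up step
-- reaches height k.
peaks : ℕ → ℕ → ℕ → ℕ
peaks k zero    h = 0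
peaks k (suc L) h = (if suc h ≡ᵇ k then downWalks L h else 0) + peaks k L (suc h) + lower 1 h (peaks k L)

updown-scale : ∀ c h (X V : ℕ → ℕ) → (∀ h' → X h' ≡ c * V h') →
  X (suc h) + lower 1 h X ≡ c * (V (suc h) + lower 1 h V)
updown-scale c h X V X≗cV = begin
  X (suc h) + lower 1 h X                     ≡⟨ cong₂ _+_ (X≗cV (suc h)) (lower-cong 1 h X≗cV) ⟩
  c * V (suc h) + lower 1 h (λ x → c * V x)   ≡⟨ cong (c * V (suc h) +_) (sym (*-distribˡ-lower c 1 h V)) ⟩
  c * V (suc h) + c * lower 1 h V             ≡⟨ sym (*-distribˡ-+ c (V (suc h)) _) ⟩
  c * (V (suc h) + lower 1 h V)               ∎
  where open ≡-Reasoning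

pascal-shift : ∀ (g : ℕ → ℕ) n j →
  (n C j) * g (suc (n ∸ j)) + lower 1 j (λ j' → (n C j') * g (n ∸ j')) ≡ (suc n C j) * g (suc n ∸ j)
pascal-shift g n zero    = +-identityʳ _
pascal-shift g n (suc j) = begin
  (n C suc j) * g (suc (n ∸ suc j)) + (n C j) * g (n ∸ j) ≡⟨ cong (_+ (n C j) * g (n ∸ j)) aligned ⟩
  (n C suc j) * g (n ∸ j) + (n C j) * g (n ∸ j)           ≡⟨ sym (*-distribʳ-+ (g (n ∸ j)) (n C suc j) (n C j)) ⟩
  (n C suc j + n C j) * g (n ∸ j)                         ≡⟨ cong (_* g (n ∸ j)) (+-comm (n C suc j) (n C j)) ⟩
  (n C j + n C suc j) * g (n ∸ j)                         ≡⟨ cong (_* g (n ∸ j)) (nCk+nC[k+1]≡[n+1]C[k+1] n j) ⟩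
  (suc n C suc j) * g (n ∸ j)                             ∎
  where
  open ≡-Reasoning
  aligned : (n C suc j) * g (suc (n ∸ suc j)) ≡ (n C suc j) * g (n ∸ j)
  aligned with suc j ≤? n
  ... | yes j<n = cong (λ L → (n C suc j) * g L) (sym (+-∸-assoc 1 j<n))
  ... | no  j≮n rewrite k>n⇒nCk≡0 (≰⇒> j≮n) = refl

-- X n h j counts objects of length n with j flat steps and Y (n ∸ j) h their flat-free
-- skeletons: when stripping a first up or down step acts on X as on Y, the j flat steps
-- can be placed in any of C(n, j) ways.
flat-insertion : (X : ℕ → ℕ → ℕ → ℕ) (Y : ℕ → ℕ → ℕ) →
  (∀ h j → X 0 h j ≡ (0 C j) * Y 0 h) →
  (∀ n h j → (∀ h' → X n h' j ≡ (n C j) * Y (n ∸ j) h') →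
             X (suc n) h j ≡ (n C j) * Y (suc (n ∸ j)) h + lower 1 j (X n h)) →
  ∀ n h j → X n h j ≡ (n C j) * Y (n ∸ j) h
flat-insertion X Y X-zero X-suc zero    h zero    = X-zero h zero
flat-insertion X Y X-zero X-suc zero    h (suc j) = X-zero h (suc j)
flat-insertion X Y X-zero X-suc (suc n) h j = begin
  X (suc n) h j
    ≡⟨ X-suc n h j (λ h' → flat-insertion X Y X-zero X-suc n h' j) ⟩
  (n C j) * Y (suc (n ∸ j)) h + lower 1 j (X n h)
    ≡⟨ cong ((n C j) * Y (suc (n ∸ j)) h +_) (lower-cong 1 j (flat-insertion X Y X-zero X-suc n h)) ⟩
  (n C j) * Y (suc (n ∸ j)) h + lower 1 j (λ j' → (n C j') * Y (n ∸ j') h)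
    ≡⟨ pascal-shift (λ L → Y L h) n j ⟩
  (suc n C j) * Y (suc n ∸ j) h ∎
  where open ≡-Reasoning

paths-closed : ∀ n h j → paths n h j ≡ (n C j) * walks (n ∸ j) h 0
paths-closed = flat-insertion paths (λ L h → walks L h 0) base step
  where
  base : ∀ h j → paths 0 h j ≡ (0 C j) * walks 0 h 0
  base zero    zero    = refl
  base zero    (suc j) = refl
  base (suc h) j       = sym (*-zeroʳ (0 C j))
  step : ∀ n h j → (∀ h' → paths n h' j ≡ (n C j) * walks (n ∸ j) h' 0) →
         paths (suc n) h j ≡ (n C j) * walks (suc (n ∸ j)) h 0 + lower 1 j (paths n h)
  step n h j ih = trans (paths-suc n h j)
    (cong (_+ lower 1 j (paths n h)) (updown-scale (n C j) h (λ h' → paths n h' j) (λ h' → walks (n ∸ j) h' 0) ih))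

pathsWith-flatsThenD-closed : ∀ n h j →
  pathsWith flatsThenD n (suc h) j ≡ (n C j) * downWalks (n ∸ j) h
pathsWith-flatsThenD-closed =
  flat-insertion (λ n h j → pathsWith flatsThenD n (suc h) j) downWalks
    (λ h j → sym (*-zeroʳ (0 C j)))
    (λ n h j _ → trans (pathsWith-flatsThenD-suc n h j)
                         (cong (_+ lower 1 j (pathsWith flatsThenD n (suc h))) (paths-closed n h j)))

marks-step : ∀ t k n h j c L →
  pathsWith t n (suc h) j ≡ c * downWalks L h →
  (∀ h' → marks t k n h' j ≡ c * peaks k L h') →
  (if suc h ≡ᵇ k then pathsWith t n (suc h) j else 0) + marks t k n (suc h) j + lower 1 h (λ h' → marks t k n h' j)
    ≡ c * peaks k (suc L) h
marks-step t k n h j c L tail ih = begin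
  here + marks t k n (suc h) j + lower 1 h (λ h' → marks t k n h' j)
    ≡⟨ +-assoc here (marks t k n (suc h) j) _ ⟩
  here + (marks t k n (suc h) j + lower 1 h (λ h' → marks t k n h' j))
    ≡⟨ cong₂ _+_ (trans (cong (if suc h ≡ᵇ k then_else 0) tail) (sym (*-if c (suc h ≡ᵇ k) _)))
                 (updown-scale c h (λ h' → marks t k n h' j) (peaks k L) ih) ⟩
  c * here′ + c * (peaks k L (suc h) + lower 1 h (peaks k L))
    ≡⟨ sym (*-distribˡ-+ c here′ _) ⟩
  c * (here′ + (peaks k L (suc h) + lower 1 h (peaks k L)))
    ≡⟨ cong (c *_) (sym (+-assoc here′ _ _)) ⟩
  c * peaks k (suc L) h ∎
  where
  open ≡-Reasoning
  here here′ : ℕ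
  here  = if suc h ≡ᵇ k then pathsWith t n (suc h) j else 0
  here′ = if suc h ≡ᵇ k then downWalks L h else 0

peaks-one : ∀ k h → peaks k 1 h ≡ 0
peaks-one k h = cong₂ (λ x y → x + 0 + y) (if-zero (suc h ≡ᵇ k) refl) (lower-zero 1 h)

humps-closed : ∀ k n h j → marks flatsThenD k n h j ≡ (n C j) * peaks k (n ∸ j) h
humps-closed k = flat-insertion (marks flatsThenD k) (peaks k) base step
  where
  base : ∀ h j → marks flatsThenD k 0 h j ≡ (0 C j) * 0
  base h j = trans (Σpaths-nil h j (countFrom flatsThenD k h) refl) (sym (*-zeroʳ (0 C j)))
  step : ∀ n h j → (∀ h' → marks flatsThenD k n h' j ≡ (n C j) * peaks k (n ∸ j) h') →
         marks flatsThenD k (suc n) h j ≡ (n C j) * peaks k (suc (n ∸ j)) h + lower 1 j (marks flatsThenD k n h)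
  step n h j ih = trans (marks-suc flatsThenD k n h j) (cong (_+ lower 1 j (marks flatsThenD k n h))
    (marks-step flatsThenD k n h j (n C j) (n ∸ j) (pathsWith-flatsThenD-closed n h j) ih))

-- In a path of length n + 1 the two steps of a peak act as one, which leaves n slots for the flats.
peaks-closed : ∀ k n h j → marks startsD k (suc n) h j ≡ (n C j) * peaks k (suc (n ∸ j)) h
peaks-closed k = flat-insertion (λ n → marks startsD k (suc n)) (λ L → peaks k (suc L)) base step
  where
  no-peak-in-one-step : ∀ h w → length w ≡ 1 → countFrom startsD k h w ≡ 0
  no-peak-in-one-step h (U ∷ []) _ rewrite ∧-zeroʳ (suc h ≡ᵇ k) = refl
  no-peak-in-one-step h (D ∷ []) _ = refl
  no-peak-in-one-step h (F ∷ []) _ = refl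
  base : ∀ h j → marks startsD k 1 h j ≡ (0 C j) * peaks k 1 h
  base h j = begin
    marks startsD k 1 h j  ≡⟨ Σpaths-cong 1 h j (no-peak-in-one-step h) ⟩
    Σpaths 1 h j (λ _ → 0) ≡⟨ Σpaths-zero 1 h j ⟩
    0                      ≡⟨ sym (*-zeroʳ (0 C j)) ⟩
    (0 C j) * 0            ≡⟨ cong ((0 C j) *_) (sym (peaks-one k h)) ⟩
    (0 C j) * peaks k 1 h  ∎
    where open ≡-Reasoning
  step : ∀ n h j → (∀ h' → marks startsD k (suc n) h' j ≡ (n C j) * peaks k (suc (n ∸ j)) h') →
         marks startsD k (suc (suc n)) h j ≡ (n C j) * peaks k (suc (suc (n ∸ j))) h + lower 1 j (marks startsD k (suc n) h)
  step n h j ih = trans (marks-suc startsD k (suc n) h j) (cong (_+ lower 1 j (marks startsD k (suc n) h))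
    (marks-step startsD k (suc n) h j (n C j) (suc (n ∸ j)) (trans (pathsWith-startsD-suc n h j) (paths-closed n h j)) ih))

-- Walks and the reflection principle

walks-suc-last : ∀ L h t → walks (suc L) h t ≡ walks L h (suc t) + lower 1 t (walks L h)
walks-suc-last zero    zero    zero    = refl
walks-suc-last zero    zero    (suc t) = +-identityʳ _
walks-suc-last zero    (suc h) zero    = sym (+-identityʳ _)
walks-suc-last zero    (suc h) (suc t) = +-comm (b2n (suc h ≡ᵇ t)) _
walks-suc-last (suc L) h t = begin
  walks (suc L) (suc h) t + lower 1 h (λ h' → walks (suc L) h' t)
    ≡⟨ cong₂ _+_ (walks-suc-last L (suc h) t) (lower-cong 1 h (λ h' → walks-suc-last L h' t)) ⟩
  (walks L (suc h) (suc t) + lower 1 t (walks L (suc h)))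
    + lower 1 h (λ h' → walks L h' (suc t) + lower 1 t (walks L h'))
    ≡⟨ cong (walks L (suc h) (suc t) + lower 1 t (walks L (suc h)) +_) (lower-+ 1 h _ _) ⟩
  (walks L (suc h) (suc t) + lower 1 t (walks L (suc h)))
    + (lower 1 h (λ h' → walks L h' (suc t)) + lower 1 h (λ h' → lower 1 t (walks L h')))
    ≡⟨ +-interchange (walks L (suc h) (suc t)) _ _ _ ⟩
  walks (suc L) h (suc t) + (lower 1 t (walks L (suc h)) + lower 1 h (λ h' → lower 1 t (walks L h')))
    ≡⟨ cong (λ z → walks (suc L) h (suc t) + (lower 1 t (walks L (suc h)) + z)) (lower-comm h t (walks L)) ⟩
  walks (suc L) h (suc t) + (lower 1 t (walks L (suc h)) + lower 1 t (λ t' → lower 1 h (λ h' → walks L h' t')))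
    ≡⟨ cong (walks (suc L) h (suc t) +_) (sym (lower-+ 1 t _ _)) ⟩
  walks (suc L) h (suc t) + lower 1 t (walks (suc L) h) ∎
  where open ≡-Reasoning

walks-sym : ∀ L h t → walks L h t ≡ walks L t h
walks-sym zero    zero    zero    = refl
walks-sym zero    zero    (suc t) = refl
walks-sym zero    (suc h) zero    = refl
walks-sym zero    (suc h) (suc t) = walks-sym zero h t
walks-sym (suc L) h t = begin
  walks L (suc h) t + lower 1 h (λ h' → walks L h' t)
    ≡⟨ cong₂ _+_ (walks-sym L (suc h) t) (lower-cong 1 h (λ h' → walks-sym L h' t)) ⟩
  walks L t (suc h) + lower 1 h (walks L t)
    ≡⟨ sym (walks-suc-last L t h) ⟩
  walks (suc L) t h ∎
  where open ≡-Reasoning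

walks-unreachable : ∀ L h t → L + h < t → walks L h t ≡ 0
walks-unreachable zero    zero    (suc t) _ = refl
walks-unreachable zero    (suc h) (suc t) (s≤s h<t) = walks-unreachable zero h t h<t
walks-unreachable (suc L) h t L+h<t =
  cong₂ _+_ (walks-unreachable L (suc h) t (subst (_< t) (sym (+-suc L h)) L+h<t)) (down h L+h<t)
  where
  down : ∀ h → suc L + h < t → lower 1 h (λ h' → walks L h' t) ≡ 0
  down zero    _     = refl
  down (suc h) L+h<t = walks-unreachable L h t (<-trans (+-monoʳ-< L (n<1+n h)) (<-trans (n<1+n _) L+h<t))

walks-diag : ∀ h → walks h h 0 ≡ 1
walks-diag zero    = refl
walks-diag (suc h) = trans (cong (_+ walks h h 0) overshoot) (walks-diag h)
  where
  overshoot : walks h (suc (suc h)) 0 ≡ 0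
  overshoot = trans (walks-sym h (suc (suc h)) 0) (walks-unreachable h 0 (suc (suc h)) (s≤s (≤-trans (≤-reflexive (+-identityʳ h)) (n≤1+n h))))

walks-odd : ∀ L h t → (L + h + t) % 2 ≡ 1 → walks L h t ≡ 0
walks-odd zero    zero    zero    ()
walks-odd zero    zero    (suc t) _ = refl
walks-odd zero    (suc h) zero    _ = refl
walks-odd zero    (suc h) (suc t) odd rewrite +-suc h t = walks-odd zero h t odd
walks-odd (suc L) h t odd = cong₂ _+_ (walks-odd L (suc h) t (trans (cong (λ x → (x + t) % 2) (+-suc L h)) odd)) (down h odd)
  where
  down : ∀ h → (suc L + h + t) % 2 ≡ 1 → lower 1 h (λ h' → walks L h' t) ≡ 0
  down zero    _   = refl
  down (suc h) odd rewrite +-suc L h = walks-odd L h t odd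

pascal-lower : ∀ n k → suc n C k ≡ lower 1 k (n C_) + n C k
pascal-lower n zero    = refl
pascal-lower n (suc k) = sym (nCk+nC[k+1]≡[n+1]C[k+1] n k)

central-C-sym : ∀ i → (i + suc i) C i ≡ (i + suc i) C suc i
central-C-sym i = trans (nCk≡nC[n∸k] (m≤m+n i (suc i))) (cong ((i + suc i) C_) (m+n∸m≡n i (suc i)))

twice-suc : ∀ i h → 2 * suc i + h ≡ suc (2 * i + suc h)
twice-suc = solve-∀

-- The reflection principle walks L h 0 = C(L, i) − C(L, i − 1), written without subtraction
-- (lower 1 i (L C_) is C(L, i − 1), and 0 when i = 0).
reflection : ∀ i h L → L ≡ 2 * i + h → walks L h 0 + lower 1 i (L C_) ≡ L C i
reflection zero    h       L       refl = trans (+-identityʳ _) (walks-diag h)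
reflection (suc i) h       zero    ()
reflection (suc i) zero    (suc L) L+1≡ = begin
  walks L 1 0 + 0 + suc L C i                   ≡⟨ cong₂ _+_ (+-identityʳ _) (pascal-lower L i) ⟩
  walks L 1 0 + (lower 1 i (L C_) + L C i)      ≡⟨ sym (+-assoc (walks L 1 0) _ _) ⟩
  walks L 1 0 + lower 1 i (L C_) + L C i        ≡⟨ cong (_+ L C i) (reflection i 1 L L≡) ⟩
  L C i + L C i                                 ≡⟨ cong (L C i +_) middle ⟩
  L C i + L C suc i                             ≡⟨ nCk+nC[k+1]≡[n+1]C[k+1] L i ⟩
  suc L C suc i                                 ∎
  where
  open ≡-Reasoning
  L≡ : L ≡ 2 * i + 1
  L≡ = suc-injective (trans L+1≡ (twice-suc i 0))
  odd-length : ∀ i → 2 * i + 1 ≡ i + suc i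
  odd-length = solve-∀
  middle : L C i ≡ L C suc i
  middle = subst (λ L → L C i ≡ L C suc i) (sym (trans L≡ (odd-length i))) (central-C-sym i)
reflection (suc i) (suc g) (suc L) L+1≡ = begin
  walks L (suc (suc g)) 0 + walks L g 0 + suc L C i
    ≡⟨ cong (walks L (suc (suc g)) 0 + walks L g 0 +_) (pascal-lower L i) ⟩
  walks L (suc (suc g)) 0 + walks L g 0 + (lower 1 i (L C_) + L C i)
    ≡⟨ +-interchange (walks L (suc (suc g)) 0) _ _ _ ⟩
  (walks L (suc (suc g)) 0 + lower 1 i (L C_)) + (walks L g 0 + L C i)
    ≡⟨ cong₂ _+_ (reflection i (suc (suc g)) L L≡) (reflection (suc i) g L L≡′) ⟩
  L C i + L C suc i
    ≡⟨ nCk+nC[k+1]≡[n+1]C[k+1] L i ⟩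
  suc L C suc i ∎
  where
  open ≡-Reasoning
  L≡ : L ≡ 2 * i + suc (suc g)
  L≡ = suc-injective (trans L+1≡ (twice-suc i (suc g)))
  L≡′ : L ≡ 2 * suc i + g
  L≡′ = trans L≡ (trans (+-suc (2 * i) (suc g)) (sym (twice-suc i g)))

[k+1]*nC[k+1]+k*nCk≡n*nCk : ∀ n k → suc k * (n C suc k) + k * (n C k) ≡ n * (n C k)
[k+1]*nC[k+1]+k*nCk≡n*nCk zero    zero    = refl
[k+1]*nC[k+1]+k*nCk≡n*nCk zero    (suc k) = cong₂ _+_ (*-zeroʳ (suc (suc k))) (*-zeroʳ (suc k))
[k+1]*nC[k+1]+k*nCk≡n*nCk (suc n) zero    =
  trans (+-identityʳ _) (trans (*-identityˡ _) (trans (nC1≡n (suc n)) (sym (*-identityʳ (suc n)))))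
[k+1]*nC[k+1]+k*nCk≡n*nCk (suc n) (suc k) = begin
  (2 + k) * (suc n C suc (suc k)) + (1 + k) * (suc n C suc k)
    ≡⟨ sym (cong₂ (λ x y → (2 + k) * x + (1 + k) * y) (nCk+nC[k+1]≡[n+1]C[k+1] n (suc k)) (nCk+nC[k+1]≡[n+1]C[k+1] n k)) ⟩
  (2 + k) * (P + Q) + (1 + k) * (R + P)
    ≡⟨ regroup k P Q R ⟩
  ((2 + k) * Q + (1 + k) * P) + ((1 + k) * P + k * R) + (R + P)
    ≡⟨ cong₂ (λ x y → x + y + (R + P)) ([k+1]*nC[k+1]+k*nCk≡n*nCk n (suc k)) ([k+1]*nC[k+1]+k*nCk≡n*nCk n k) ⟩
  n * P + n * R + (R + P)
    ≡⟨ collect n P R ⟩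
  (1 + n) * (R + P)
    ≡⟨ cong ((1 + n) *_) (nCk+nC[k+1]≡[n+1]C[k+1] n k) ⟩
  (1 + n) * (suc n C suc k) ∎
  where
  open ≡-Reasoning
  P Q R : ℕ
  P = n C suc k
  Q = n C suc (suc k)
  R = n C k
  regroup : ∀ k P Q R → (2 + k) * (P + Q) + (1 + k) * (R + P) ≡ ((2 + k) * Q + (1 + k) * P) + ((1 + k) * P + k * R) + (R + P)
  regroup = solve-∀
  collect : ∀ n P R → n * P + n * R + (R + P) ≡ (1 + n) * (R + P)
  collect = solve-∀

ballot : ∀ h i → (suc h + i) * walks (2 * i + h) h 0 ≡ suc h * ((2 * i + h) C i)
ballot h i = +-cancelʳ-≡ _ _ _ (begin
  (suc h + i) * W + (suc h + i) * Y   ≡⟨ sym (*-distribˡ-+ (suc h + i) W Y) ⟩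
  (suc h + i) * (W + Y)               ≡⟨ cong ((suc h + i) *_) (reflection i h L refl) ⟩
  (suc h + i) * X                     ≡⟨ *-distribʳ-+ X (suc h) i ⟩
  suc h * X + i * X                   ≡⟨ cong (suc h * X +_) (absorbed i) ⟩
  suc h * X + (suc h + i) * Y         ∎)
  where
  open ≡-Reasoning
  L W X Y : ℕ
  L = 2 * i + h
  W = walks L h 0
  X = L C i
  Y = lower 1 i (L C_)
  length-split : ∀ h i → 2 * suc i + h ≡ (suc h + suc i) + i
  length-split = solve-∀
  absorbed : ∀ i → i * ((2 * i + h) C i) ≡ (suc h + i) * lower 1 i ((2 * i + h) C_)
  absorbed zero    = sym (*-zeroʳ (suc h + 0))
  absorbed (suc i) = +-cancelʳ-≡ _ _ _ (begin
    suc i * (L′ C suc i) + i * (L′ C i)   ≡⟨ [k+1]*nC[k+1]+k*nCk≡n*nCk L′ i ⟩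
    L′ * (L′ C i)                         ≡⟨ cong (_* (L′ C i)) (length-split h i) ⟩
    (suc h + suc i + i) * (L′ C i)        ≡⟨ *-distribʳ-+ (L′ C i) (suc h + suc i) i ⟩
    (suc h + suc i) * (L′ C i) + i * (L′ C i) ∎)
    where
    L′ : ℕ
    L′ = 2 * suc i + h

-- Peaks of height k

lower-δ : ∀ m h c → lower m h (λ g → b2n (g ≡ᵇ c)) ≡ b2n (h ≡ᵇ m + c)
lower-δ zero    h       c = refl
lower-δ (suc m) zero    c = refl
lower-δ (suc m) (suc h) c = lower-δ m h c

lower-step : ∀ m h (f : ℕ → ℕ) →
  lower m h f + lower 1 h (λ h' → lower (suc m) h' f) ≡
  (if h ≡ᵇ m then f 0 else 0) + lower (suc m) h (λ g → f (suc g) + lower 1 g f)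
lower-step zero    zero    f = refl
lower-step zero    (suc h) f = refl
lower-step (suc m) zero    f = refl
lower-step (suc m) (suc h) f = trans (cong (lower m h f +_) (lower-suc (suc m) h f)) (lower-step m h f)

-- At h = 0 this is the bijection that cuts a walk from 0 to 2k − 1 at its last visit to height
-- k − 1 into a walk to k − 1, an up step, and (read backwards and shifted down by k) a walk from
-- k − 1 to 0, i.e. a peak at height k.  The correction term for h ≥ k makes the identity hold for
-- every start, so that it follows by induction on the first step.
walks-to-odd : ∀ c L h → walks L h (suc (c + c)) ≡ peaks (suc c) (suc L) h + lower (suc c) h (λ g → walks L g c)
walks-to-odd c zero    h = sym (cong₂ _+_ (peaks-one (suc c) h) (lower-δ (suc c) h c))
walks-to-odd c (suc L) h = begin
  walks L (suc h) (suc (c + c)) + lower 1 h (λ h' → walks L h' (suc (c + c)))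
    ≡⟨ cong₂ _+_ (walks-to-odd c L (suc h)) (trans (lower-cong 1 h (walks-to-odd c L)) (lower-+ 1 h P _)) ⟩
  (P (suc h) + lower c h f) + (lower 1 h P + lower 1 h (λ h' → lower (suc c) h' f))
    ≡⟨ +-interchange (P (suc h)) _ _ _ ⟩
  (P (suc h) + lower 1 h P) + (lower c h f + lower 1 h (λ h' → lower (suc c) h' f))
    ≡⟨ cong (P (suc h) + lower 1 h P +_) (lower-step c h f) ⟩
  (P (suc h) + lower 1 h P) + ((if h ≡ᵇ c then walks L 0 c else 0) + lower (suc c) h (λ g → walks (suc L) g c))
    ≡⟨ cong (λ x → P (suc h) + lower 1 h P + (x + lower (suc c) h (λ g → walks (suc L) g c))) (peak-term h) ⟩
  (P (suc h) + lower 1 h P) + ((if h ≡ᵇ c then walks L h 0 else 0) + lower (suc c) h (λ g → walks (suc L) g c))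
    ≡⟨ regroup (P (suc h)) (lower 1 h P) (if h ≡ᵇ c then walks L h 0 else 0) (lower (suc c) h (λ g → walks (suc L) g c)) ⟩
  peaks (suc c) (suc (suc L)) h + lower (suc c) h (λ g → walks (suc L) g c) ∎
  where
  open ≡-Reasoning
  P f : ℕ → ℕ
  P = peaks (suc c) (suc L)
  f g = walks L g c
  peak-term : ∀ h → (if h ≡ᵇ c then walks L 0 c else 0) ≡ (if h ≡ᵇ c then walks L h 0 else 0)
  peak-term h with h ≡ᵇ c in h≡ᵇc
  ... | false = refl
  ... | true rewrite ≡ᵇ-true⇒≡ h c h≡ᵇc = walks-sym L 0 c
  regroup : ∀ a b x y → (a + b) + (x + y) ≡ x + a + b + y
  regroup = solve-∀

peaks-as-walks : ∀ c L → peaks (suc c) (suc L) 0 ≡ walks L 0 (suc (c + c))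
peaks-as-walks c L = sym (trans (walks-to-odd c L 0) (+-identityʳ _))

peaks-short : ∀ c d → d ≤ suc (c + c) → peaks (suc c) d 0 ≡ 0
peaks-short c zero    _         = refl
peaks-short c (suc L) (s≤s L≤) =
  trans (peaks-as-walks c L) (walks-unreachable L 0 (suc (c + c)) (s≤s (subst (_≤ c + c) (sym (+-identityʳ L)) L≤)))

peaks-odd : ∀ c m → peaks (suc c) (suc (m * 2)) 0 ≡ 0
peaks-odd c m = trans (peaks-as-walks c (m * 2)) (walks-odd (m * 2) 0 (suc (c + c)) odd-sum)
  where
  as-odd : ∀ m c → m * 2 + 0 + suc (c + c) ≡ 1 + (m + c) * 2
  as-odd = solve-∀
  odd-sum : (m * 2 + 0 + suc (c + c)) % 2 ≡ 1
  odd-sum = trans (cong (_% 2) (as-odd m c)) ([m+kn]%n≡m%n 1 (m + c) 2)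

EvenPeaksFormula : ℕ → ℕ → Set
EvenPeaksFormula c m = (suc m * 2 + 2 * suc c) * peaks (suc c) (suc m * 2) 0 ≡ 4 * suc c * (suc (m * 2) C (m + suc c))

peaks-even-below : ∀ c m → m < c → EvenPeaksFormula c m
peaks-even-below c m m<c = begin
  (suc m * 2 + 2 * suc c) * peaks (suc c) (suc m * 2) 0
    ≡⟨ cong ((suc m * 2 + 2 * suc c) *_) (peaks-short c (suc m * 2) (subst (_≤ suc (c + c)) (sym (double-suc m)) (s≤s (+-mono-< m<c m<c)))) ⟩
  (suc m * 2 + 2 * suc c) * 0
    ≡⟨ *-zeroʳ (suc m * 2 + 2 * suc c) ⟩
  0
    ≡⟨ sym (*-zeroʳ (4 * suc c)) ⟩
  4 * suc c * 0
    ≡⟨ cong (4 * suc c *_) (sym (k>n⇒nCk≡0 (subst (_< m + suc c) (sym (double-suc′ m)) (+-monoʳ-< m (s≤s m<c))))) ⟩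
  4 * suc c * (suc (m * 2) C (m + suc c)) ∎
  where
  open ≡-Reasoning
  double-suc : ∀ m → suc m * 2 ≡ suc (suc (m + m))
  double-suc = solve-∀
  double-suc′ : ∀ m → suc (m * 2) ≡ m + suc m
  double-suc′ = solve-∀

peaks-even-above : ∀ c i → EvenPeaksFormula c (c + i)
peaks-even-above c i = begin
  (suc (c + i) * 2 + 2 * suc c) * peaks (suc c) (suc (c + i) * 2) 0
    ≡⟨ cong₂ _*_ (multiplier c i) (peaks-as-walks c L) ⟩
  2 * (suc t + i) * walks L 0 t
    ≡⟨ cong (2 * (suc t + i) *_) (trans (walks-sym L 0 t) (cong (λ L → walks L t 0) (L-as-ballot c i))) ⟩
  2 * (suc t + i) * walks (2 * i + t) t 0
    ≡⟨ *-assoc 2 (suc t + i) (walks (2 * i + t) t 0) ⟩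
  2 * ((suc t + i) * walks (2 * i + t) t 0)
    ≡⟨ cong (2 *_) (ballot t i) ⟩
  2 * (suc t * ((2 * i + t) C i))
    ≡⟨ sym (*-assoc 2 (suc t) ((2 * i + t) C i)) ⟩
  2 * suc t * ((2 * i + t) C i)
    ≡⟨ cong₂ _*_ (four c) (trans (cong (_C i) (sym (L-as-ballot c i))) mirror) ⟩
  4 * suc c * (L C (c + i + suc c)) ∎
  where
  open ≡-Reasoning
  t L : ℕ
  t = suc (c + c)
  L = suc ((c + i) * 2)
  multiplier : ∀ c i → suc (c + i) * 2 + 2 * suc c ≡ 2 * (suc (suc (c + c)) + i)
  multiplier = solve-∀
  L-as-ballot : ∀ c i → suc ((c + i) * 2) ≡ 2 * i + suc (c + c)
  L-as-ballot = solve-∀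
  four : ∀ c → 2 * suc (suc (c + c)) ≡ 4 * suc c
  four = solve-∀
  L-split : ∀ c i → suc ((c + i) * 2) ≡ (c + i + suc c) + i
  L-split = solve-∀
  mirror : L C i ≡ L C (c + i + suc c)
  mirror = trans (nCk≡nC[n∸k] (subst (i ≤_) (sym (L-split c i)) (m≤n+m i _)))
                 (cong (L C_) (trans (cong (_∸ i) (L-split c i)) (m+n∸n≡m _ i)))

peaks-even : ∀ c m → EvenPeaksFormula c m
peaks-even c m with m <? c
... | yes m<c = peaks-even-below c m m<c
... | no  m≮c = subst (EvenPeaksFormula c) (m+[n∸m]≡n (≮⇒≥ m≮c)) (peaks-even-above c (m ∸ c))

toℚᵘ-frac : ∀ a d → toℚᵘ (frac a (suc d)) ≃ᵘ mkℚᵘ (ℤ.+ a) d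
toℚᵘ-frac a d = toℚᵘ-fromℚᵘ (mkℚᵘ (ℤ.+ a) d)

frac-cross : ∀ a d b e → a * suc e ≡ b * suc d → frac a (suc d) ≡ frac b (suc e)
frac-cross a d b e ad≡bc = toℚᵘ-injective (begin
  toℚᵘ (frac a (suc d))   ≈⟨ toℚᵘ-frac a d ⟩
  mkℚᵘ (ℤ.+ a) d          ≈⟨ *≡* (trans (sym (ℤ.pos-* a (suc e))) (trans (cong ℤ.+_ ad≡bc) (ℤ.pos-* b (suc d)))) ⟩
  mkℚᵘ (ℤ.+ b) e          ≈⟨ toℚᵘ-frac b e ⟨
  toℚᵘ (frac b (suc e))   ∎)
  where open ℚᵘ.≃-Reasoning

frac-* : ∀ a d b e → frac a (suc d) *ℚ frac b (suc e) ≡ frac (a * b) (suc d * suc e)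
frac-* a d b e = toℚᵘ-injective (begin
  toℚᵘ (frac a (suc d) *ℚ frac b (suc e))            ≈⟨ toℚᵘ-homo-* (frac a (suc d)) (frac b (suc e)) ⟩
  toℚᵘ (frac a (suc d)) ℚᵘ.* toℚᵘ (frac b (suc e))   ≈⟨ ℚᵘ.*-cong (toℚᵘ-frac a d) (toℚᵘ-frac b e) ⟩
  mkℚᵘ (ℤ.+ a ℤ.* ℤ.+ b) (e + d * suc e)             ≡⟨ cong (λ n → mkℚᵘ n (e + d * suc e)) (sym (ℤ.pos-* a b)) ⟩
  mkℚᵘ (ℤ.+ (a * b)) (e + d * suc e)                 ≈⟨ toℚᵘ-frac (a * b) (e + d * suc e) ⟨
  toℚᵘ (frac (a * b) (suc d * suc e))                ∎)
  where open ℚᵘ.≃-Reasoning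

ℕtoℚ-+ : ∀ a b → ℕtoℚ (a + b) ≡ ℕtoℚ a +ℚ ℕtoℚ b
ℕtoℚ-+ a b = toℚᵘ-injective (begin
  toℚᵘ (ℕtoℚ (a + b))                  ≈⟨ toℚᵘ-frac (a + b) 0 ⟩
  mkℚᵘ (ℤ.+ (a + b)) 0                  ≡⟨ cong (λ n → mkℚᵘ n 0) numerator ⟩
  mkℚᵘ (ℤ.+ a) 0 ℚᵘ.+ mkℚᵘ (ℤ.+ b) 0    ≈⟨ ℚᵘ.+-cong (toℚᵘ-frac a 0) (toℚᵘ-frac b 0) ⟨
  toℚᵘ (ℕtoℚ a) ℚᵘ.+ toℚᵘ (ℕtoℚ b)      ≈⟨ toℚᵘ-homo-+ (ℕtoℚ a) (ℕtoℚ b) ⟨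
  toℚᵘ (ℕtoℚ a +ℚ ℕtoℚ b)              ∎)
  where
  open ℚᵘ.≃-Reasoning
  numerator : ℤ.+ (a + b) ≡ (ℤ.+ a) ℤ.* (ℤ.+ 1) ℤ.+ (ℤ.+ b) ℤ.* (ℤ.+ 1)
  numerator = trans (ℤ.pos-+ a b) (sym (cong₂ ℤ._+_ (ℤ.*-identityʳ (ℤ.+ a)) (ℤ.*-identityʳ (ℤ.+ b))))

frac-value : ∀ a D B X z → 0 < D → D * z ≡ a * B * X → 1ℚ *ℚ frac a D *ℚ ℕtoℚ B *ℚ ℕtoℚ X ≡ ℕtoℚ z
frac-value a (suc e) B X z _ ez≡aBX = begin
  1ℚ *ℚ frac a (suc e) *ℚ ℕtoℚ B *ℚ ℕtoℚ X   ≡⟨ cong (λ q → q *ℚ ℕtoℚ B *ℚ ℕtoℚ X) (*ℚ-identityˡ (frac a (suc e))) ⟩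
  frac a (suc e) *ℚ ℕtoℚ B *ℚ ℕtoℚ X         ≡⟨ cong (_*ℚ ℕtoℚ X) (frac-* a e B 0) ⟩
  frac (a * B) (suc e * 1) *ℚ ℕtoℚ X         ≡⟨ frac-* (a * B) (e * 1) X 0 ⟩
  frac (a * B * X) (suc e * 1 * 1)           ≡⟨ frac-cross (a * B * X) _ z 0 cross ⟩
  ℕtoℚ z                                     ∎
  where
  open ≡-Reasoning
  unit : ∀ e z → suc e * z ≡ z * (suc e * 1 * 1)
  unit = solve-∀
  cross : a * B * X * 1 ≡ z * (suc e * 1 * 1)
  cross = trans (*-identityʳ (a * B * X)) (trans (sym ez≡aBX) (unit e z))

*ℚ-zeroˡ³ : ∀ p q r → 0ℚ *ℚ p *ℚ q *ℚ r ≡ 0ℚ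
*ℚ-zeroˡ³ p q r = trans (cong (λ x → x *ℚ q *ℚ r) (*ℚ-zeroˡ p)) (trans (cong (_*ℚ r) (*ℚ-zeroˡ q)) (*ℚ-zeroˡ r))

ℕtoℚ-sumBelowℕ : ∀ M (f : ℕ → ℕ) → ℕtoℚ (sumBelowℕ M f) ≡ sumBelow M (λ j → ℕtoℚ (f j))
ℕtoℚ-sumBelowℕ zero    f = refl
ℕtoℚ-sumBelowℕ (suc M) f = trans (ℕtoℚ-+ (sumBelowℕ M f) (f M)) (cong (_+ℚ ℕtoℚ (f M)) (ℕtoℚ-sumBelowℕ M f))

ℕtoℚ-sum-cutoff : ∀ N M (a : ℕ → ℕ) (q : ℕ → ℚ) → M ≤ N → (∀ j → M ≤ j → a j ≡ 0) →
  (∀ j → j < M → ℕtoℚ (a j) ≡ q j) → ℕtoℚ (sumBelowℕ N a) ≡ sumBelow M q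
ℕtoℚ-sum-cutoff N M a q M≤N tail-zero head = begin
  ℕtoℚ (sumBelowℕ N a)               ≡⟨ cong (λ N → ℕtoℚ (sumBelowℕ N a)) (sym (m+[n∸m]≡n M≤N)) ⟩
  ℕtoℚ (sumBelowℕ (M + (N ∸ M)) a)   ≡⟨ cong ℕtoℚ (sumBelowℕ-truncate M (N ∸ M) a tail-zero) ⟩
  ℕtoℚ (sumBelowℕ M a)               ≡⟨ ℕtoℚ-sumBelowℕ M a ⟩
  sumBelow M (λ j → ℕtoℚ (a j))      ≡⟨ sumBelow-cong M head ⟩
  sumBelow M q                       ∎
  where open ≡-Reasoning

data Parity : ℕ → Set where
  even : ∀ m → Parity (m * 2)
  odd  : ∀ m → Parity (1 + m * 2)

parity : ∀ n → Parity n
parity zero = even 0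
parity (suc n) with parity n
... | even m = odd m
... | odd  m = even (suc m)

%2-suc : ∀ n → (n % 2 ≡ᵇ suc n % 2) ≡ false
%2-suc zero          = refl
%2-suc (suc zero)    = refl
%2-suc (suc (suc n)) = %2-suc n

parity-even : ∀ j m → (j % 2 ≡ᵇ (j + m * 2) % 2) ≡ true
parity-even j m = trans (cong (j % 2 ≡ᵇ_) ([m+kn]%n≡m%n j m 2)) (≡ᵇ-refl (j % 2))

parity-odd : ∀ j m → (j % 2 ≡ᵇ (j + (1 + m * 2)) % 2) ≡ false
parity-odd j m = trans (cong (λ x → j % 2 ≡ᵇ x % 2) (+-suc j (m * 2)))
                       (trans (cong (j % 2 ≡ᵇ_) ([m+kn]%n≡m%n (suc j) m 2)) (%2-suc j))

even/2 : ∀ m → m * 2 / 2 ≡ m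
even/2 m = m*n/n≡m m 2

*-rescale : ∀ b {p q x y} → p * x ≡ q * y → p * (b * x) ≡ q * b * y
*-rescale b {p} {q} {x} {y} px≡qy = begin
  p * (b * x)   ≡⟨ x*[y*z]≡y*[x*z] p b x ⟩
  b * (p * x)   ≡⟨ cong (b *_) px≡qy ⟩
  b * (q * y)   ≡⟨ x*[y*z]≡y*x*z b q y ⟩
  q * b * y     ∎
  where
  open ≡-Reasoning
  x*[y*z]≡y*[x*z] : ∀ x y z → x * (y * z) ≡ y * (x * z)
  x*[y*z]≡y*[x*z] = solve-∀
  x*[y*z]≡y*x*z : ∀ x y z → x * (y * z) ≡ y * x * z
  x*[y*z]≡y*x*z = solve-∀

-- The j-th summand of the theorem for order n, with d = n − j and B the binomial factor
-- (C(n, j) for humps, C(n − 1, j) for peaks).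
summand : ℕ → ℕ → ℕ → ℕ → ℕ → ℚ
summand k j n d B = χ (j % 2 ≡ᵇ n % 2) *ℚ frac (4 * k) (d + 2 * k) *ℚ ℕtoℚ B *ℚ ℕtoℚ ((d ∸ 1) C (d / 2 + k ∸ 1))

summand-value : ∀ c B j {d} → Parity d → 0 < d → ℕtoℚ (B * peaks (suc c) d 0) ≡ summand (suc c) j (j + d) d B
summand-value c B j (even zero)    ()
summand-value c B j (even (suc m)) _ =
  trans (sym (frac-value (4 * suc c) (suc m * 2 + 2 * suc c) B X (B * peaks (suc c) (suc m * 2) 0) (s≤s z≤n)
                         (*-rescale B {suc m * 2 + 2 * suc c} {4 * suc c} (trans (peaks-even c m) (cong (4 * suc c *_) binomial)))))
        (cong (λ b → χ b *ℚ frac (4 * suc c) (suc m * 2 + 2 * suc c) *ℚ ℕtoℚ B *ℚ ℕtoℚ X) (sym (parity-even j (suc m))))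
  where
  X : ℕ
  X = (suc m * 2 ∸ 1) C (suc m * 2 / 2 + suc c ∸ 1)
  binomial : suc (m * 2) C (m + suc c) ≡ X
  binomial = cong (λ h → suc (m * 2) C (h + suc c ∸ 1)) (sym (even/2 (suc m)))
summand-value c B j (odd m)        _ =
  trans (cong ℕtoℚ (trans (cong (B *_) (peaks-odd c m)) (*-zeroʳ B)))
        (trans (sym (*ℚ-zeroˡ³ W (ℕtoℚ B) (ℕtoℚ X)))
               (cong (λ b → χ b *ℚ W *ℚ ℕtoℚ B *ℚ ℕtoℚ X) (sym (parity-odd j m))))
  where
  W : ℚ
  W = frac (4 * suc c) (1 + m * 2 + 2 * suc c)
  X : ℕ
  X = (1 + m * 2 ∸ 1) C ((1 + m * 2) / 2 + suc c ∸ 1)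

summand-value′ : ∀ c B {n j} → j < n → ℕtoℚ (B * peaks (suc c) (n ∸ j) 0) ≡ summand (suc c) j n (n ∸ j) B
summand-value′ c B {n} {j} j<n with n ∸ j | m+[n∸m]≡n (<⇒≤ j<n) | m<n⇒0<n∸m j<n
... | d | refl | 0<d = summand-value c B j (parity d) 0<d

Σmotzkin-cutoff : ∀ n M (g : List Step → ℕ) (q : ℕ → ℚ) → M ≤ suc n →
  (∀ j → M ≤ j → Σwords n (λ w → if isMotzkin w ∧ (flats w ≡ᵇ j) then g w else 0) ≡ 0) →
  (∀ j → j < M → ℕtoℚ (Σwords n (λ w → if isMotzkin w ∧ (flats w ≡ᵇ j) then g w else 0)) ≡ q j) →
  ℕtoℚ (Σwords n (λ w → if isMotzkin w then g w else 0)) ≡ sumBelow M q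
Σmotzkin-cutoff n M g q M≤1+n tail-zero head =
  trans (cong ℕtoℚ (Σmotzkin-by-flats n g)) (ℕtoℚ-sum-cutoff (suc n) M _ q M≤1+n tail-zero head)

HMflat-value : ∀ n c j → j < n → ℕtoℚ (HMflat n (suc c) j) ≡ summand (suc c) j n (n ∸ j) (n C j)
HMflat-value n c j j<n = trans (cong ℕtoℚ (humps-closed (suc c) n 0 j)) (summand-value′ c (n C j) j<n)

PMflat-value : ∀ n c j → j < suc n → ℕtoℚ (PMflat (suc n) (suc c) j) ≡ summand (suc c) j (suc n) (suc n ∸ j) (n C j)
PMflat-value n c j j<1+n = trans (cong ℕtoℚ (trans (peaks-closed (suc c) n 0 j) (cong (λ d → (n C j) * peaks (suc c) d 0) d≡)))
                                 (summand-value′ c (n C j) j<1+n)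
  where
  d≡ : suc (n ∸ j) ≡ suc n ∸ j
  d≡ = sym (+-∸-assoc 1 (s≤s⁻¹ j<1+n))

beyond-cutoff : ∀ n c j → suc n ∸ 2 * suc c ≤ j → n ≤ j + suc (c + c)
beyond-cutoff n c j M≤j = s≤s⁻¹ (begin
  suc n                               ≤⟨ m≤n+m∸n (suc n) (2 * suc c) ⟩
  2 * suc c + (suc n ∸ 2 * suc c)     ≤⟨ +-monoʳ-≤ (2 * suc c) M≤j ⟩
  2 * suc c + j                       ≡⟨ double c j ⟩
  suc (j + suc (c + c))               ∎)
  where
  open ≤-Reasoning
  double : ∀ c j → 2 * suc c + j ≡ suc (j + suc (c + c))
  double = solve-∀

HMflat-beyond-cutoff : ∀ n c j → suc n ∸ 2 * suc c ≤ j → HMflat n (suc c) j ≡ 0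
HMflat-beyond-cutoff n c j M≤j = trans (humps-closed (suc c) n 0 j)
  (trans (cong ((n C j) *_) (peaks-short c (n ∸ j) (m≤n+o⇒m∸n≤o n j (beyond-cutoff n c j M≤j)))) (*-zeroʳ (n C j)))

PMflat-beyond-cutoff : ∀ n c j → suc (suc n) ∸ 2 * suc c ≤ j → PMflat (suc n) (suc c) j ≡ 0
PMflat-beyond-cutoff n c j M≤j = trans (peaks-closed (suc c) n 0 j)
  (trans (cong ((n C j) *_) (peaks-short c (suc (n ∸ j)) (s≤s (m≤n+o⇒m∸n≤o n j n≤j+2c))))
         (*-zeroʳ (n C j)))
  where
  n≤j+2c : n ≤ j + (c + c)
  n≤j+2c = s≤s⁻¹ (subst (suc n ≤_) (+-suc j (c + c)) (beyond-cutoff (suc n) c j M≤j))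

theorem1p1 : (n k : ℕ) → 2 ≤ n → 1 ≤ k →
    (ℕtoℚ (HM n k) ≡ sumBelow (suc n ∸ 2 * k) (λ j → χ (j % 2 ≡ᵇ n % 2) *ℚ frac (4 * k) (n ∸ j + 2 * k) *ℚ ℕtoℚ (n C j) *ℚ ℕtoℚ ((n ∸ j ∸ 1) C ((n ∸ j) / 2 + k ∸ 1))))
    × (ℕtoℚ (PM n k) ≡ sumBelow (suc n ∸ 2 * k) (λ j → χ (j % 2 ≡ᵇ n % 2) *ℚ frac (4 * k) (n ∸ j + 2 * k) *ℚ ℕtoℚ ((n ∸ 1) C j) *ℚ ℕtoℚ ((n ∸ j ∸ 1) C ((n ∸ j) / 2 + k ∸ 1))))
    × ((j : ℕ) → j ≤ n ∸ 2 * k →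
        (ℕtoℚ (HMflat n k j) ≡ χ (j % 2 ≡ᵇ n % 2) *ℚ frac (4 * k) (n ∸ j + 2 * k) *ℚ ℕtoℚ (n C j) *ℚ ℕtoℚ ((n ∸ j ∸ 1) C ((n ∸ j) / 2 + k ∸ 1)))
        × (ℕtoℚ (PMflat n k j) ≡ χ (j % 2 ≡ᵇ n % 2) *ℚ frac (4 * k) (n ∸ j + 2 * k) *ℚ ℕtoℚ ((n ∸ 1) C j) *ℚ ℕtoℚ ((n ∸ j ∸ 1) C ((n ∸ j) / 2 + k ∸ 1))))
theorem1p1 (suc n) (suc c) _ _ =
    Σmotzkin-cutoff N M (humpsOfHeight k) _ M≤1+N (HMflat-beyond-cutoff N c) (λ j j<M → HMflat-value N c j (below-cutoff j<M))
  , Σmotzkin-cutoff N M (peaksOfHeight k) _ M≤1+N (PMflat-beyond-cutoff n c) (λ j j<M → PMflat-value n c j (below-cutoff j<M))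
  , λ j j≤ → HMflat-value N c j (in-range j≤) , PMflat-value n c j (in-range j≤)
  where
  N k M : ℕ
  N = suc n
  k = suc c
  M = suc N ∸ 2 * k
  M≤1+N : M ≤ suc N
  M≤1+N = m∸n≤m (suc N) (2 * k)
  below-cutoff : ∀ {j} → j < M → j < N
  below-cutoff j<M = ≤-trans j<M (m∸n≤m N (pred (2 * k)))
  in-range : ∀ {j} → j ≤ N ∸ 2 * k → j < N
  in-range j≤ = s≤s (≤-trans j≤ (m∸n≤m n (pred (2 * k))))
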